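{- Let $f:A\to\mathbb R^n$ and $g:B\to\mathbb R^n$ be functions that faithfully realize simplicial complexes $C$ and $D$ respectively (where $\bigcup C\subseteq A$ and $\bigcup D\subseteq B$), and suppose $\bigcup g(D)\subseteq\bigcup f(C)$. If $L:\mathbb R^n\to\mathbb R^m$ is a linear transformation such that $L\circ f$ faithfully realizes $C$, then $L\circ g$ faithfully realizes $D$.
   Context: A simplicial complex is a set $C=P(\alpha_1)\cup\ldots\cup P(\alpha_k)$, $k\ge1$, with $P(\cdot)$ the power set and the $\alpha_i$ finite pairwise $\subseteq$-incomparable sets. A function $f$ defined on $\bigcup C$ with values in $\mathbb R^n$ faithfully realizes $C$ if for all $\alpha,\beta\in C$ and all positive reals $k_a$ ($a\in\alpha$), $l_b$ ($b\in\beta$), the equality $\sum_{a\in\alpha}k_a f(a)=\sum_{b\in\beta}l_b f(b)$ implies $\alpha=\beta$ and $k_a=l_a$ for every $a\in\alpha$. For such $f$, $f(C)=\{\mathrm{cone}(\{f(a)\mid a\in\alpha\})\mid \alpha\in C\}$, where $\mathrm{cone}(S)$ is the set of nonnegative real linear combinations of $S$ ($\mathrm{cone}(\emptyset)=\{0\}$); so $\bigcup f(C)$ is the union of these cones. -}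

module Defs where

open import Level using (0ℓ)
open import Data.Nat using (ℕ)
open import Data.Fin using (Fin)
open import Data.List using (List; []; _∷_; length; lookup)
open import Data.List.Membership.Propositional using (_∈_)
open import Data.List.Relation.Unary.Any using (Any)
open import Data.List.Relation.Unary.All using (All)
open import Data.List.Relation.Unary.Unique.Propositional using (Unique)
open import Data.Product using (Σ; ∃; _×_; _,_)
open import Data.Sum using (_⊎_)
open import Relation.Nullary using (¬_)
open import Relation.Binary.PropositionalEquality using (_≡_; _≢_)
open import Algebra.Structures using (IsCommutativeRing)
open import Relation.Binary.Structures using (IsStrictTotalOrder)

-- An axiomatization of the real numbers: a complete ordered field
-- (unique up to isomorphism), with propositional equality on the carrier.
record RealField : Set₁ where
  infixl 6 _+_
  infixl 7 _*_
  infix 4 _<_ _≤_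
  field
    Carrier : Set
    _+_ _*_ : Carrier → Carrier → Carrier
    -_      : Carrier → Carrier
    0# 1#   : Carrier
    _<_     : Carrier → Carrier → Set
    isCommutativeRing  : IsCommutativeRing _≡_ _+_ _*_ -_ 0# 1#
    0≢1                : 0# ≢ 1#
    inverse            : ∀ x → x ≢ 0# → ∃ λ y → x * y ≡ 1#
    isStrictTotalOrder : IsStrictTotalOrder _≡_ _<_
    +-mono-<           : ∀ {a b} c → a < b → a + c < b + c
    *-pos              : ∀ {a b} → 0# < a → 0# < b → 0# < a * b
  _≤_ : Carrier → Carrier → Set
  a ≤ b = a < b ⊎ a ≡ b
  field
    completeness : (P : Carrier → Set) → ∃ P → (∃ λ u → ∀ x → P x → x ≤ u) →
                   ∃ λ s → (∀ x → P x → x ≤ s) × (∀ u → (∀ x → P x → x ≤ u) → s ≤ u)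

-- Finite sets of elements of A are represented by duplicate-free lists.
_⊆_ : {A : Set} → List A → List A → Set
α ⊆ β = ∀ a → a ∈ α → a ∈ β

_≈set_ : {A : Set} → List A → List A → Set
α ≈set β = α ⊆ β × β ⊆ α

-- A simplicial complex C = P(α_1) ∪ … ∪ P(α_k), k ≥ 1, α_i finite and
-- pairwise ⊆-incomparable.
record SimplicialComplex (A : Set) : Set where
  field
    facets       : List (List A)
    nonempty     : facets ≢ []
    facetsFinSet : All Unique facets
    incomparable : (i j : Fin (length facets)) → i ≢ j →
                   ¬ (lookup facets i ⊆ lookup facets j)

_∈C_ : {A : Set} → List A → SimplicialComplex A → Set
α ∈C C = Unique α × Any (α ⊆_) (SimplicialComplex.facets C)

module Over (R : RealField) where
  open RealField R public

  Vec : ℕ → Set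
  Vec n = Fin n → Carrier

  _≈v_ : {n : ℕ} → Vec n → Vec n → Set
  x ≈v y = ∀ i → x i ≡ y i

  0v : {n : ℕ} → Vec n
  0v i = 0#

  _+v_ : {n : ℕ} → Vec n → Vec n → Vec n
  (x +v y) i = x i + y i

  _·v_ : {n : ℕ} → Carrier → Vec n → Vec n
  (c ·v x) i = c * x i

  linComb : {A : Set} {n : ℕ} → (A → Carrier) → (A → Vec n) → List A → Vec n
  linComb k f []      = 0v
  linComb k f (a ∷ α) = (k a ·v f a) +v linComb k f α

  record IsLinear {n m : ℕ} (L : Vec n → Vec m) : Set where
    field
      cong     : ∀ {x y} → x ≈v y → L x ≈v L y
      additive : ∀ x y → L (x +v y) ≈v (L x +v L y)
      homog    : ∀ c x → L (c ·v x) ≈v (c ·v L x)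

  FaithfullyRealizes : {A : Set} {n : ℕ} → (A → Vec n) → SimplicialComplex A → Set
  FaithfullyRealizes f C =
    ∀ α β → α ∈C C → β ∈C C → (k l : _ → Carrier) →
    (∀ a → a ∈ α → 0# < k a) → (∀ b → b ∈ β → 0# < l b) →
    linComb k f α ≈v linComb l f β →
    (α ≈set β) × (∀ a → a ∈ α → k a ≡ l a)

  InUnionCones : {A : Set} {n : ℕ} → (A → Vec n) → SimplicialComplex A → Vec n → Set
  InUnionCones f C x =
    ∃ λ α → α ∈C C × ∃ λ (k : _ → Carrier) → (∀ a → a ∈ α → 0# ≤ k a) × (x ≈v linComb k f α)

-- Faithfulness of L ∘ f makes L injective on ⋃ f(C): a point of a cone is a
-- positive combination over some face (drop the zero coefficients), and
-- faithfulness identifies the faces and coefficients of two positive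
-- combinations with the same image under L.  Now if L(Σ k g(α)) = L(Σ l g(β)),
-- both sums lie in ⋃ g(D) ⊆ ⋃ f(C), hence are equal, and faithfulness of g
-- concludes.
module Submission where

open import Defs
open import Data.Nat using (ℕ)
open import Function using (_∘_; mk⇔)
open import Data.List using (List; []; _∷_; filter)
open import Data.List.Membership.Propositional using (_∈_)
open import Data.List.Membership.Propositional.Properties using (∈-filter⁻)
open import Data.List.Membership.Propositional.Properties.WithK using (unique∧set⇒bag)
open import Data.List.Relation.Binary.BagAndSetEquality using (∼bag⇒↭)
open import Data.List.Relation.Binary.Permutation.Propositional as ↭ using (_↭_)
import Data.List.Relation.Unary.Any as Any
open import Data.List.Relation.Unary.Unique.Propositional using (Unique)
open import Data.List.Relation.Unary.Unique.Propositional.Properties using (filter⁺)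
open import Data.Product using (∃; _×_; _,_; proj₁; proj₂)
open import Data.Sum using (inj₁; inj₂)
open import Relation.Nullary using (yes; no; contradiction)
open import Relation.Binary.PropositionalEquality
  using (_≡_; refl; sym; trans; cong; cong₂; module ≡-Reasoning)
open import Relation.Binary.Structures using (IsStrictTotalOrder)
open import Algebra.Bundles using (CommutativeRing)
import Algebra.Properties.CommutativeSemigroup as CommutativeSemigroupProperties

module _ {A : Set} where

  ≈set⇒↭ : {α β : List A} → Unique α → Unique β → α ≈set β → α ↭ β
  ≈set⇒↭ α-unique β-unique (α⊆β , β⊆α) =
    ∼bag⇒↭ (unique∧set⇒bag α-unique β-unique (mk⇔ (α⊆β _) (β⊆α _)))

  ∈C-⊆ : {C : SimplicialComplex A} {α β : List A} →
         Unique β → β ⊆ α → α ∈C C → β ∈C C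
  ∈C-⊆ β-unique β⊆α (_ , α⊆facet) =
    β-unique , Any.map (λ α⊆σ a a∈β → α⊆σ a (β⊆α a a∈β)) α⊆facet

module Cones (R : RealField) where
  open Over R
  private
    ring : CommutativeRing _ _
    ring = record { isCommutativeRing = isCommutativeRing }
  open CommutativeRing ring using (+-identityˡ; zeroˡ; +-commutativeSemigroup)
  open CommutativeSemigroupProperties +-commutativeSemigroup using (x∙yz≈y∙xz)
  open IsStrictTotalOrder isStrictTotalOrder using (_<?_)

  module _ {A : Set} where

    support : (A → Carrier) → List A → List A
    support k = filter (λ a → 0# <? k a)

    ∈-support⁻ : (k : A → Carrier) (α : List A) {a : A} →
                 a ∈ support k α → a ∈ α × 0# < k a
    ∈-support⁻ k α = ∈-filter⁻ (λ a → 0# <? k a)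

    Unique-support : (k : A → Carrier) {α : List A} → Unique α → Unique (support k α)
    Unique-support k = filter⁺ (λ a → 0# <? k a)

  module _ {A : Set} {n : ℕ} (f : A → Vec n) where

    linComb-resp-↭ : (k : A → Carrier) {α β : List A} →
                     α ↭ β → linComb k f α ≈v linComb k f β
    linComb-resp-↭ k ↭.refl i = refl
    linComb-resp-↭ k (↭.prep a α↭β) i = cong (k a * f a i +_) (linComb-resp-↭ k α↭β i)
    linComb-resp-↭ k (↭.swap a b α↭β) i =
      trans (cong (λ s → k a * f a i + (k b * f b i + s)) (linComb-resp-↭ k α↭β i))
            (x∙yz≈y∙xz _ _ _)
    linComb-resp-↭ k (↭.trans α↭β β↭γ) i =
      trans (linComb-resp-↭ k α↭β i) (linComb-resp-↭ k β↭γ i)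

    linComb-cong : {k l : A → Carrier} (α : List A) →
                   (∀ a → a ∈ α → k a ≡ l a) → linComb k f α ≈v linComb l f α
    linComb-cong [] k≡l i = refl
    linComb-cong (a ∷ α) k≡l i =
      cong₂ (λ c s → c * f a i + s)
            (k≡l a (Any.here refl)) (linComb-cong α (λ b b∈α → k≡l b (Any.there b∈α)) i)

    linComb-support : (k : A → Carrier) (α : List A) → (∀ a → a ∈ α → 0# ≤ k a) →
                      linComb k f (support k α) ≈v linComb k f α
    linComb-support k [] k≥0 i = refl
    linComb-support k (a ∷ α) k≥0 i
      with 0# <? k a | k≥0 a (Any.here refl)
         | linComb-support k α (λ b b∈α → k≥0 b (Any.there b∈α)) i
    ... | yes _   | _         | ih = cong (k a * f a i +_) ih
    ... | no 0≮ka | inj₁ 0<ka | _  = contradiction 0<ka 0≮ka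
    ... | no _    | inj₂ 0≡ka | ih = begin
      linComb k f (support k α) i    ≡⟨ ih ⟩
      linComb k f α i                ≡⟨ +-identityˡ _ ⟨
      0# + linComb k f α i           ≡⟨ cong (_+ linComb k f α i) (zeroˡ (f a i)) ⟨
      0# * f a i + linComb k f α i   ≡⟨ cong (λ c → c * f a i + linComb k f α i) 0≡ka ⟩
      k a * f a i + linComb k f α i  ∎
      where open ≡-Reasoning

  module _ {n m : ℕ} {L : Vec n → Vec m} (L-linear : IsLinear L) where
    open IsLinear L-linear renaming (cong to L-cong)

    linear-0v : L 0v ≈v 0v
    linear-0v i = begin
      L 0v i          ≡⟨ L-cong (λ _ → sym (zeroˡ 0#)) i ⟩
      L (0# ·v 0v) i  ≡⟨ homog 0# 0v i ⟩
      0# * L 0v i     ≡⟨ zeroˡ _ ⟩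
      0#              ∎
      where open ≡-Reasoning

    linear-linComb : {A : Set} (k : A → Carrier) (f : A → Vec n) (α : List A) →
                     L (linComb k f α) ≈v linComb k (L ∘ f) α
    linear-linComb k f [] = linear-0v
    linear-linComb k f (a ∷ α) i =
      trans (additive _ _ i) (cong₂ _+_ (homog (k a) (f a) i) (linear-linComb k f α i))

  module _ {A : Set} {n : ℕ} (f : A → Vec n) (C : SimplicialComplex A) where

    InUnionCones⁺ : Vec n → Set
    InUnionCones⁺ x =
      ∃ λ α → α ∈C C × ∃ λ (k : A → Carrier) → (∀ a → a ∈ α → 0# < k a) × (x ≈v linComb k f α)

    InUnionCones⇒⁺ : ∀ {x} → InUnionCones f C x → InUnionCones⁺ x
    InUnionCones⇒⁺ (α , α∈C , k , k≥0 , x≈) =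
      support k α ,
      ∈C-⊆ {C = C} (Unique-support k (proj₁ α∈C)) (λ _ → proj₁ ∘ ∈-support⁻ k α) α∈C ,
      k , (λ _ → proj₂ ∘ ∈-support⁻ k α) ,
      λ i → trans (x≈ i) (sym (linComb-support f k α k≥0 i))

    positive⇒InUnionCones : {α : List A} → α ∈C C → (k : A → Carrier) →
      (∀ a → a ∈ α → 0# < k a) → InUnionCones f C (linComb k f α)
    positive⇒InUnionCones {α} α∈C k k>0 = α , α∈C , k , (λ a a∈α → inj₁ (k>0 a a∈α)) , λ _ → refl

    faithful∘⇒injective-on-cones : {m : ℕ} {L : Vec n → Vec m} → IsLinear L →
      FaithfullyRealizes (L ∘ f) C → ∀ {x y} →
      InUnionCones f C x → InUnionCones f C y → L x ≈v L y → x ≈v y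
    faithful∘⇒injective-on-cones {L = L} L-linear Lf-faithful {x} {y} x∈ y∈ Lx≈Ly
      with InUnionCones⇒⁺ x∈ | InUnionCones⇒⁺ y∈
    ... | γ , γ∈C , p , p>0 , x≈ | δ , δ∈C , q , q>0 , y≈ = λ i → begin
      x i                  ≡⟨ x≈ i ⟩
      linComb p f γ i      ≡⟨ linComb-cong f γ p≡q i ⟩
      linComb q f γ i      ≡⟨ linComb-resp-↭ f q (≈set⇒↭ (proj₁ γ∈C) (proj₁ δ∈C) γ≈δ) i ⟩
      linComb q f δ i      ≡⟨ y≈ i ⟨
      y i                  ∎
      where
      open IsLinear L-linear renaming (cong to L-cong)
      open ≡-Reasoning
      Lfγ≈Lfδ : linComb p (L ∘ f) γ ≈v linComb q (L ∘ f) δ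
      Lfγ≈Lfδ i = begin
        linComb p (L ∘ f) γ i  ≡⟨ linear-linComb L-linear p f γ i ⟨
        L (linComb p f γ) i    ≡⟨ L-cong (λ j → sym (x≈ j)) i ⟩
        L x i                  ≡⟨ Lx≈Ly i ⟩
        L y i                  ≡⟨ L-cong y≈ i ⟩
        L (linComb q f δ) i    ≡⟨ linear-linComb L-linear q f δ i ⟩
        linComb q (L ∘ f) δ i  ∎
      γ≈δ,p≡q = Lf-faithful γ δ γ∈C δ∈C p q p>0 q>0 Lfγ≈Lfδ
      γ≈δ = proj₁ γ≈δ,p≡q
      p≡q = proj₂ γ≈δ,p≡q

proposition6p1 : (R : RealField) → let open Over R in
    {A B : Set} {n m : ℕ} (C : SimplicialComplex A) (D : SimplicialComplex B)
    (f : A → Vec n) (g : B → Vec n) →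
    FaithfullyRealizes f C → FaithfullyRealizes g D →
    (∀ x → InUnionCones g D x → InUnionCones f C x) →
    (L : Vec n → Vec m) → IsLinear L →
    FaithfullyRealizes (L ∘ f) C →
    FaithfullyRealizes (L ∘ g) D
proposition6p1 R C D f g _ g-faithful g⊆f L L-linear Lf-faithful
               α β α∈D β∈D k l k>0 l>0 Lgα≈Lgβ =
  g-faithful α β α∈D β∈D k l k>0 l>0
    (faithful∘⇒injective-on-cones f C L-linear Lf-faithful
      (g⊆f _ (positive⇒InUnionCones g D α∈D k k>0))
      (g⊆f _ (positive⇒InUnionCones g D β∈D l l>0))
      λ i → trans (linear-linComb L-linear k g α i)
              (trans (Lgα≈Lgβ i) (sym (linear-linComb L-linear l g β i))))
  where open Cones R
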